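{- Let $\leq$ be a partial entrenchment on $\mathcal{L}$ and $\mid\!\sim$ a preferential inference relation on $\mathcal{L}$. Define $N(\leq)$ by: $\alpha\,N(\leq)\,\beta$ iff $\neg\alpha\lor\neg\beta\leq\neg\alpha$; and define $P(\mid\!\sim)$ by: $\alpha\,P(\mid\!\sim)\,\beta$ iff $\neg\alpha\lor\neg\beta\mid\!\sim\neg\alpha$. Then (1) $P(N(\leq))=\leq$, and (2) $N(P(\mid\!\sim))=\mid\!\sim$.
   Context: $\mathcal{L}$ is a propositional language closed under $\neg,\lor,\land,\to$; $\vdash$ classical consequence. A partial entrenchment is a binary relation $\leq$ on $\mathcal{L}$ satisfying Transitivity, Dominance ($\alpha\vdash\beta\Rightarrow\alpha\leq\beta$) and Conjunction ($\gamma\leq\alpha,\gamma\leq\beta\Rightarrow\gamma\leq\alpha\land\beta$). A preferential inference relation is a relation $\mid\!\sim\subseteq\mathcal{L}\times\mathcal{L}$ satisfying system $\mathbf{P}$: Supraclassicality ($\alpha\vdash\beta\Rightarrow\alpha\mid\!\sim\beta$); Left Logical Equivalence ($\alpha,\beta$ classically equivalent and $\alpha\mid\!\sim\gamma$ $\Rightarrow\beta\mid\!\sim\gamma$); Right Weakening ($\alpha\mid\!\sim\beta$, $\beta\vdash\gamma\Rightarrow\alpha\mid\!\sim\gamma$); And ($\alpha\mid\!\sim\beta$, $\alpha\mid\!\sim\gamma\Rightarrow\alpha\mid\!\sim\beta\land\gamma$); Cut ($\alpha\mid\!\sim\beta$, $\alpha\land\beta\mid\!\sim\gamma\Rightarrow\alpha\mid\!\sim\gamma$);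 Cautious Monotonicity ($\alpha\mid\!\sim\beta$, $\alpha\mid\!\sim\gamma\Rightarrow\alpha\land\beta\mid\!\sim\gamma$); Or ($\alpha\mid\!\sim\gamma$, $\beta\mid\!\sim\gamma\Rightarrow\alpha\lor\beta\mid\!\sim\gamma$); Weak Transitivity ($\alpha\lor\beta\mid\!\sim\alpha$, $\beta\lor\gamma\mid\!\sim\beta\Rightarrow\alpha\lor\gamma\mid\!\sim\alpha$). -}

module Defs where

open import Data.Bool using (Bool; true; false; not; _∧_; _∨_)
open import Data.Product using (_×_)
open import Relation.Binary.PropositionalEquality using (_≡_)
open import Relation.Binary.Core using (Rel)
open import Level using (0ℓ)

data Form (A : Set) : Set where
  atom : A → Form A
  ¬'_  : Form A → Form A
  _∨'_ : Form A → Form A → Form A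
  _∧'_ : Form A → Form A → Form A
  _⇒'_ : Form A → Form A → Form A

infix  9 ¬'_
infixr 8 _∧'_
infixr 7 _∨'_
infixr 6 _⇒'_

module _ {A : Set} where

  ⟦_⟧ : Form A → (A → Bool) → Bool
  ⟦ atom p ⟧ v = v p
  ⟦ ¬' a ⟧ v = not (⟦ a ⟧ v)
  ⟦ a ∨' b ⟧ v = ⟦ a ⟧ v ∨ ⟦ b ⟧ v
  ⟦ a ∧' b ⟧ v = ⟦ a ⟧ v ∧ ⟦ b ⟧ v
  ⟦ a ⇒' b ⟧ v = not (⟦ a ⟧ v) ∨ ⟦ b ⟧ v

  _⊢_ : Form A → Form A → Set
  α ⊢ β = (v : A → Bool) → ⟦ α ⟧ v ≡ true → ⟦ β ⟧ v ≡ true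

  _≡c_ : Form A → Form A → Set
  α ≡c β = (α ⊢ β) × (β ⊢ α)

  record IsPartialEntrenchment (_≤_ : Rel (Form A) 0ℓ) : Set where
    field
      trans     : ∀ {α β γ} → α ≤ β → β ≤ γ → α ≤ γ
      dominance : ∀ {α β} → α ⊢ β → α ≤ β
      conjunction : ∀ {α β γ} → γ ≤ α → γ ≤ β → γ ≤ (α ∧' β)

  record IsPreferential (_∣~_ : Rel (Form A) 0ℓ) : Set where
    field
      supraclassicality : ∀ {α β} → α ⊢ β → α ∣~ β
      lle    : ∀ {α β γ} → α ≡c β → α ∣~ γ → β ∣~ γ
      rw     : ∀ {α β γ} → α ∣~ β → β ⊢ γ → α ∣~ γ
      and    : ∀ {α β γ} → α ∣~ β → α ∣~ γ → α ∣~ (β ∧' γ)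
      cut    : ∀ {α β γ} → α ∣~ β → (α ∧' β) ∣~ γ → α ∣~ γ
      cm     : ∀ {α β γ} → α ∣~ β → α ∣~ γ → (α ∧' β) ∣~ γ
      or     : ∀ {α β γ} → α ∣~ γ → β ∣~ γ → (α ∨' β) ∣~ γ
      wtrans : ∀ {α β γ} → (α ∨' β) ∣~ α → (β ∨' γ) ∣~ β → (α ∨' γ) ∣~ α

  N : Rel (Form A) 0ℓ → Rel (Form A) 0ℓ
  N _≤_ α β = ((¬' α) ∨' (¬' β)) ≤ (¬' α)

  P : Rel (Form A) 0ℓ → Rel (Form A) 0ℓ
  P _∣~_ α β = ((¬' α) ∨' (¬' β)) ∣~ (¬' α)

  _≐_ : Rel (Form A) 0ℓ → Rel (Form A) 0ℓ → Set
  R ≐ S = ∀ α β → (R α β → S α β) × (S α β → R α β)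

-- Unfolding the definitions, α P(N(R)) β and α N(P(R)) β both say
-- R (¬(¬α ∨ ¬β) ∨ ¬¬α) (¬(¬α ∨ ¬β)), whose two arguments are classically
-- equivalent to α and α ∧ β. Entrenchments and preferential relations are
-- insensitive to classical equivalence of their arguments, and both satisfy
-- α R (α ∧ β) ⇔ α R β, so this is just α R β.
module Submission where

open import Defs
open import Data.Bool using (true; false; not) renaming (_∧_ to _∧ᵇ_; _∨_ to _∨ᵇ_)
open import Data.Product using (_×_; _,_; swap)
open import Function using (id)
open import Function.Bundles using (_⇔_; mk⇔; Equivalence)
open import Relation.Binary.Core using (Rel)
open import Relation.Binary.PropositionalEquality using (_≡_; refl; sym; subst)
open import Level using (0ℓ)

open Equivalence using (to; from)

module _ {A : Set} where

  -- The formulas are explicit because _≡c_ unfolds to a type from which they cannot be inferred.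
  ≡c-from-⟦⟧ : (φ ψ : Form A) → (∀ v → ⟦ φ ⟧ v ≡ ⟦ ψ ⟧ v) → φ ≡c ψ
  ≡c-from-⟦⟧ _ _ eq = (λ v → subst (_≡ true) (eq v)) , (λ v → subst (_≡ true) (sym (eq v)))

  ∧-⊢ʳ : (α β : Form A) → (α ∧' β) ⊢ β
  ∧-⊢ʳ α β v h with ⟦ α ⟧ v
  ... | true = h

  ¬[¬∨¬]≡c∧ : (α β : Form A) → (¬' (¬' α ∨' ¬' β)) ≡c (α ∧' β)
  ¬[¬∨¬]≡c∧ α β =
    ≡c-from-⟦⟧ (¬' (¬' α ∨' ¬' β)) (α ∧' β) λ v → deMorgan (⟦ α ⟧ v) (⟦ β ⟧ v)
    where
    deMorgan : ∀ a b → not (not a ∨ᵇ not b) ≡ a ∧ᵇ b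
    deMorgan true  true  = refl
    deMorgan true  false = refl
    deMorgan false _     = refl

  ¬[¬∨¬]∨¬¬≡c : (α β : Form A) → (¬' (¬' α ∨' ¬' β) ∨' ¬' ¬' α) ≡c α
  ¬[¬∨¬]∨¬¬≡c α β =
    ≡c-from-⟦⟧ (¬' (¬' α ∨' ¬' β) ∨' ¬' ¬' α) α λ v → absorb (⟦ α ⟧ v) (⟦ β ⟧ v)
    where
    absorb : ∀ a b → not (not a ∨ᵇ not b) ∨ᵇ not (not a) ≡ a
    absorb true  true  = refl
    absorb true  false = refl
    absorb false _     = refl

  RespectsEquivalence : Rel (Form A) 0ℓ → Set
  RespectsEquivalence R = ∀ {α α′ β β′} → α ≡c α′ → β ≡c β′ → R α β → R α′ β′

  ConjunctionInvariant : Rel (Form A) 0ℓ → Set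
  ConjunctionInvariant R = ∀ {α β} → R α (α ∧' β) ⇔ R α β

  N-involutive : {R : Rel (Form A) 0ℓ} → RespectsEquivalence R → ConjunctionInvariant R →
                 N (N R) ≐ R
  N-involutive resp conj α β =
      (λ h → to conj (resp (¬[¬∨¬]∨¬¬≡c α β) (¬[¬∨¬]≡c∧ α β) h))
    , (λ h → resp (swap (¬[¬∨¬]∨¬¬≡c α β)) (swap (¬[¬∨¬]≡c∧ α β)) (from conj h))

  module _ {_≤_ : Rel (Form A) 0ℓ} (E : IsPartialEntrenchment _≤_) where
    open IsPartialEntrenchment E

    entrenchment-respects-≡c : RespectsEquivalence _≤_
    entrenchment-respects-≡c (_ , α′⊢α) (β⊢β′ , _) α≤β =
      trans (dominance α′⊢α) (trans α≤β (dominance β⊢β′))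

    entrenchment-∧-invariant : ConjunctionInvariant _≤_
    entrenchment-∧-invariant {α} {β} = mk⇔
      (λ α≤α∧β → trans α≤α∧β (dominance (∧-⊢ʳ α β)))
      (conjunction (dominance (λ _ → id)))

  module _ {_∣~_ : Rel (Form A) 0ℓ} (Pr : IsPreferential _∣~_) where
    open IsPreferential Pr

    preferential-respects-≡c : RespectsEquivalence _∣~_
    preferential-respects-≡c α≡α′ (β⊢β′ , _) α∣~β = rw (lle α≡α′ α∣~β) β⊢β′

    preferential-∧-invariant : ConjunctionInvariant _∣~_
    preferential-∧-invariant {α} {β} = mk⇔
      (λ α∣~α∧β → rw α∣~α∧β (∧-⊢ʳ α β))
      (and (supraclassicality (λ _ → id)))

-- P and N are literally the same operator on relations.
lemma3 : {A : Set} (_≤_ : Rel (Form A) 0ℓ) (_∣~_ : Rel (Form A) 0ℓ) →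
         IsPartialEntrenchment _≤_ → IsPreferential _∣~_ →
         (P (N _≤_) ≐ _≤_) × (N (P _∣~_) ≐ _∣~_)
lemma3 _≤_ _∣~_ E Pr =
    N-involutive (entrenchment-respects-≡c E) (entrenchment-∧-invariant E)
  , N-involutive (preferential-respects-≡c Pr) (preferential-∧-invariant Pr)
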